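{- Let $r=2$, $s=1$ and $\sigma=(0,0,0)\in\mathbf{Rec}$. Define the binary word $w=w_0w_1w_2\cdots$ by setting, for $k\ge0$, $w_k=1$ if $f_{2,1}^{k+1}(\sigma)=f^-(f_{2,1}^{k}(\sigma))$ and $w_k=0$ if $f_{2,1}^{k+1}(\sigma)=f^+(f_{2,1}^{k}(\sigma))$. Then $w$ is the Sturmian word with slope $\alpha=\sqrt2-1$ and intercept $\beta=\alpha/2$, i.e. $w_k=\lfloor (k+1)\alpha+\beta\rfloor-\lfloor k\alpha+\beta\rfloor$ for all $k\ge0$.
   Context: Fix positive integers $r,s$ (here $r=2,s=1$). In the one-dimensional generalized rotor-router model, a particle starts at $0$, at each occupied site moves left if the label there is $L$ and right if it is $R$, then flips that label; on first reaching an unoccupied site to the left (resp. right) of the occupied interval, $r$ (resp. $s$) new consecutive sites on that side become occupied, labeled $R$; this defines $f_{r,s}$. The recurrent states $\mathbf{Rec}$ are identified with integer triples $(x,y,z)$, $x\le0\le y$, $x\le z\le y$ (the state with occupied interval $[x,y+s-1]$, labels $R$ on $[x,z-1]$, $L$ on $[z,y-1]$, $R$ on $[y,y+s-1]$). Write $f^+(x,y,z)=(x,y+s,z-y)$ and $f^-(x,y,z)=(x-r,y,z-x+1)$; then $f_{r,s}(x,y,z)=f^+(x,y,z)$ if $x+y\le z$ and $f^-(x,y,z)$ if $x+y>z$ (so $f^-$ corresponds to the particle ending on the left, $f^+$ on the right). A binary word $w_0w_1\cdots$ is Sturmian of slope $\alpha$ and intercept $\beta$ ($0\le\alpha,\beta<1$,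 $\alpha$ irrational) if $w_k=\lfloor (k+1)\alpha+\beta\rfloor-\lfloor k\alpha+\beta\rfloor$ for all $k$. -}

module Defs where

open import Data.Nat using (ℕ; zero; suc)
open import Data.Integer using (ℤ; +_; _+_; _-_; _*_; _≤_; _<_; _≤ᵇ_)
open import Data.Product using (_×_; _,_)
open import Data.Sum using (_⊎_)
open import Data.Bool using (if_then_else_)

State : Set
State = ℤ × ℤ × ℤ

r s : ℤ
r = + 2
s = + 1

f⁺ : State → State
f⁺ (x , y , z) = (x , y + s , z - y)

f⁻ : State → State
f⁻ (x , y , z) = (x - r , y , (z - x) + + 1)

f : State → State
f (x , y , z) = if (x + y) ≤ᵇ z then f⁺ (x , y , z) else f⁻ (x , y , z)

iter : ℕ → State → State
iter zero    σ = σ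
iter (suc k) σ = f (iter k σ)

σ₀ : State
σ₀ = (+ 0 , + 0 , + 0)

-- Real numbers of the form  a + b·√2  are not available; we encode the
-- needed comparisons with √2 exactly, for integers a, c and m ≥ 0:
--   a ≤ m√2   iff  a ≤ 0  or  a² ≤ 2m²
--   m√2 < c   iff  0 < c  and  2m² < c²
≤m√2 : ℤ → ℤ → Set
≤m√2 a m = (a ≤ + 0) ⊎ (a * a ≤ + 2 * (m * m))

m√2< : ℤ → ℤ → Set
m√2< m c = (+ 0 < c) × (+ 2 * (m * m) < c * c)

-- α = √2 - 1, β = α/2, so  kα + β = (2k+1)(√2 - 1)/2.
-- IsFloorKαβ k n  means  n = ⌊ kα + β ⌋, i.e.  n ≤ kα + β < n + 1, i.e.
--   2n + m ≤ m√2 < 2n + 2 + m   with  m = 2k + 1.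
IsFloorKαβ : ℕ → ℤ → Set
IsFloorKαβ k n =
  let m = + (suc (k Data.Nat.+ k)) in
  ≤m√2 (+ 2 * n + m) m × m√2< m (+ 2 * n + + 2 + m)

{-# OPTIONS --safe #-}
module Submission where

-- After a moves ending on the left and b ending on the right the state is
-- (-2a, b, a² - T b) with T b = b(b-1)/2, and the next move ends on the right
-- exactly when T (b+1) < (a+1)².  The invariant  a² ≤ T (b+1), T b < (a+1)²
-- is therefore preserved, and since 8 T (b+1) + 1 = (2b+1)² it forces
-- a = ⌊(a+b)α + β⌋.  So ⌊kα + β⌋ counts the left moves among the first k,
-- and w_k is its increment.

open import Defs
open import Data.Nat using (ℕ; suc)
open import Data.Integer using (ℤ; +_; _-_)
open import Data.Product using (Σ; _×_)
open import Relation.Binary.PropositionalEquality using (_≡_)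

open import Data.Bool using (true; false)
open import Data.Empty using (⊥-elim)
import Data.Integer as ℤ
import Data.Integer.Properties as ℤₚ
open import Algebra.Properties.AbelianGroup ℤₚ.+-0-abelianGroup using (//-rightDividesʳ)
import Data.Integer.Tactic.RingSolver as ℤ-Solver
open import Data.Nat using (zero; _+_; _*_; _≤_; _<_; z≤n; s≤s; z<s)
open import Data.Nat.Properties
  using ( +-cancelʳ-≤; +-cancelʳ-<; +-monoʳ-≤; +-monoʳ-<; +-monoˡ-≤; +-monoˡ-<
        ; *-monoʳ-≤; *-mono-≤; *-suc; *-distribˡ-+; +-suc
        ; ≤-trans; <-≤-trans; m≤m+n; n≤1+n; _<?_; ≮⇒≥)
import Data.Nat.Tactic.RingSolver as ℕ-Solver
open import Data.Product using (_,_; proj₁; proj₂)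
open import Data.Sum using (inj₂)
open import Data.Unit using (tt)
open import Function using (_∘_)
open import Relation.Nullary using (¬_; yes; no; contradiction)
open import Relation.Binary.PropositionalEquality
  using (_≢_; refl; sym; trans; cong; cong₂; subst; subst₂; module ≡-Reasoning)

triangle : ℕ → ℕ
triangle zero    = zero
triangle (suc n) = triangle n + n

[2n+1]²≡1+8*triangle[1+n] : ∀ n → (2 * n + 1) * (2 * n + 1) ≡ 1 + 8 * triangle (suc n)
[2n+1]²≡1+8*triangle[1+n] zero    = refl
[2n+1]²≡1+8*triangle[1+n] (suc n) = begin
  (2 * suc n + 1) * (2 * suc n + 1)      ≡⟨ next-odd-square n ⟩
  (2 * n + 1) * (2 * n + 1) + 8 * suc n  ≡⟨ cong (_+ 8 * suc n) ([2n+1]²≡1+8*triangle[1+n] n) ⟩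
  1 + 8 * triangle (suc n) + 8 * suc n   ≡⟨ cong suc (*-distribˡ-+ 8 (triangle (suc n)) (suc n)) ⟨
  1 + 8 * triangle (suc (suc n))         ∎
  where
  open ≡-Reasoning
  next-odd-square : ∀ n →
    (2 * (1 + n) + 1) * (2 * (1 + n) + 1) ≡ (2 * n + 1) * (2 * n + 1) + 8 * (1 + n)
  next-odd-square = ℕ-Solver.solve-∀

balance⇒≤ : ∀ {x y p q} → x + p ≡ y + q → q ≤ p → x ≤ y
balance⇒≤ {x} {y} {p} {q} eq q≤p = +-cancelʳ-≤ p x y (begin
  x + p  ≡⟨ eq ⟩
  y + q  ≤⟨ +-monoʳ-≤ y q≤p ⟩
  y + p  ∎)
  where open Data.Nat.Properties.≤-Reasoning

balance⇒< : ∀ {x y p q} → x + p ≡ y + q → p < q → y < x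
balance⇒< {x} {y} {p} {q} eq p<q = +-cancelʳ-< p y x (begin-strict
  y + p  <⟨ +-monoʳ-< y p<q ⟩
  y + q  ≡⟨ eq ⟨
  x + p  ∎)
  where open Data.Nat.Properties.≤-Reasoning

balanceℤ⇒≤ : ∀ {u v p q} → u ℤ.+ p ≡ v ℤ.+ q → q ℤ.≤ p → u ℤ.≤ v
balanceℤ⇒≤ {u} {v} {p} {q} eq q≤p = begin
  u            ≡⟨ //-rightDividesʳ p u ⟨
  u ℤ.+ p - p  ≡⟨ cong (_- p) eq ⟩
  v ℤ.+ q - p  ≤⟨ ℤₚ.+-monoˡ-≤ (ℤ.- p) (ℤₚ.+-monoʳ-≤ v q≤p) ⟩
  v ℤ.+ p - p  ≡⟨ //-rightDividesʳ p v ⟩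
  v            ∎
  where open ℤₚ.≤-Reasoning

balanceℤ⇒≥ : ∀ {u v p q} → u ℤ.+ p ≡ v ℤ.+ q → u ℤ.≤ v → q ℤ.≤ p
balanceℤ⇒≥ {u} {v} {p} {q} eq =
  balanceℤ⇒≤ (trans (ℤₚ.+-comm q v) (trans (sym eq) (ℤₚ.+-comm u p)))

pos-2*m*m : ∀ m → + (2 * (m * m)) ≡ + 2 ℤ.* (+ m ℤ.* + m)
pos-2*m*m m = trans (ℤₚ.pos-* 2 (m * m)) (cong (+ 2 ℤ.*_) (ℤₚ.pos-* m m))

≤m√2-+ : ∀ {n m} → n * n ≤ 2 * (m * m) → ≤m√2 (+ n) (+ m)
≤m√2-+ {n} {m} n²≤2m² = inj₂ (subst₂ ℤ._≤_ (ℤₚ.pos-* n n) (pos-2*m*m m) (ℤ.+≤+ n²≤2m²))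

m√2<-+ : ∀ {m c} → 2 * (m * m) < c * c → m√2< (+ m) (+ c)
m√2<-+ {c = zero}  ()
m√2<-+ {m} {suc c} 2m²<c² =
  ℤ.+<+ z<s , subst₂ ℤ._<_ (pos-2*m*m m) (ℤₚ.pos-* (suc c) (suc c)) (ℤ.+<+ 2m²<c²)

2k+1 : ℕ → ℕ
2k+1 k = suc (k + k)

isFloorKαβ-+ : ∀ k n → let m = 2k+1 k in
  (2 * n + m) * (2 * n + m) ≤ 2 * (m * m) →
  2 * (m * m) < (2 * n + 2 + m) * (2 * n + 2 + m) →
  IsFloorKαβ k (+ n)
isFloorKαβ-+ k n lower upper =
  subst (λ i → ≤m√2 (i ℤ.+ + m) (+ m) × m√2< (+ m) (i ℤ.+ + 2 ℤ.+ + m)) (ℤₚ.pos-* 2 n)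
        (≤m√2-+ {m = m} lower , m√2<-+ {m = m} upper)
  where m = 2k+1 k

record Balanced (a b : ℕ) : Set where
  field
    sq≤triangle : a * a ≤ triangle (suc b)
    triangle<sq : triangle b < suc a * suc a

open Balanced

module _ {a b : ℕ} (bal : Balanced a b) where
  private
    m = 2k+1 (a + b)
    t = triangle (suc b)

  balanced⇒8a²≤[2b+1]² : 8 * (a * a) ≤ (2 * b + 1) * (2 * b + 1)
  balanced⇒8a²≤[2b+1]² = begin
    8 * (a * a)                ≤⟨ *-monoʳ-≤ 8 (sq≤triangle bal) ⟩
    8 * t                      ≤⟨ n≤1+n (8 * t) ⟩
    1 + 8 * t                  ≡⟨ [2n+1]²≡1+8*triangle[1+n] b ⟨
    (2 * b + 1) * (2 * b + 1)  ∎
    where open Data.Nat.Properties.≤-Reasoning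

  balanced⇒[2b+1]²<8[[1+a]²+b] : (2 * b + 1) * (2 * b + 1) < 8 * (suc a * suc a + b)
  balanced⇒[2b+1]²<8[[1+a]²+b] = begin-strict
    (2 * b + 1) * (2 * b + 1)  ≡⟨ [2n+1]²≡1+8*triangle[1+n] b ⟩
    1 + 8 * t                  <⟨ +-monoˡ-< (8 * t) {1} {8} (s≤s (s≤s z≤n)) ⟩
    8 + 8 * t                  ≡⟨ *-suc 8 t ⟨
    8 * suc t                  ≤⟨ *-monoʳ-≤ 8 (+-monoˡ-≤ b (triangle<sq bal)) ⟩
    8 * (suc a * suc a + b)    ∎
    where open Data.Nat.Properties.≤-Reasoning

  balanced⇒lower : (2 * a + m) * (2 * a + m) ≤ 2 * (m * m)
  balanced⇒lower = balance⇒≤ (identity a b) balanced⇒8a²≤[2b+1]²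
    where
    identity : ∀ a b → let m = suc (a + b + (a + b)) in
      (2 * a + m) * (2 * a + m) + (2 * b + 1) * (2 * b + 1) ≡ 2 * (m * m) + 8 * (a * a)
    identity = ℕ-Solver.solve-∀

  balanced⇒upper : 2 * (m * m) < (2 * a + 2 + m) * (2 * a + 2 + m)
  balanced⇒upper = balance⇒< (identity a b) balanced⇒[2b+1]²<8[[1+a]²+b]
    where
    identity : ∀ a b → let m = suc (a + b + (a + b)) in
      (2 * a + 2 + m) * (2 * a + 2 + m) + (2 * b + 1) * (2 * b + 1)
        ≡ 2 * (m * m) + 8 * (suc a * suc a + b)
    identity = ℕ-Solver.solve-∀

  balanced⇒floor : IsFloorKαβ (a + b) (+ a)
  balanced⇒floor = isFloorKαβ-+ (a + b) a balanced⇒lower balanced⇒upper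

f≡f⁺ : ∀ {x y z} → x ℤ.+ y ℤ.≤ z → f (x , y , z) ≡ f⁺ (x , y , z)
f≡f⁺ {x} {y} {z} x+y≤z with (x ℤ.+ y) ℤ.≤ᵇ z | ℤₚ.≤⇒≤ᵇ x+y≤z
... | true  | _ = refl
... | false | ()

f≡f⁻ : ∀ {x y z} → ¬ (x ℤ.+ y ℤ.≤ z) → f (x , y , z) ≡ f⁻ (x , y , z)
f≡f⁻ {x} {y} {z} x+y≰z with (x ℤ.+ y) ℤ.≤ᵇ z | ℤₚ.≤ᵇ⇒≤ {x ℤ.+ y} {z}
... | false | _     = refl
... | true  | ≤ᵇ⇒≤ = contradiction (≤ᵇ⇒≤ tt) x+y≰z

f⁺≢f⁻ : ∀ σ → f⁺ σ ≢ f⁻ σ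
f⁺≢f⁻ (x , y , z) eq =
  ℤₚ.i≢suc[i] (trans (sym (cong (proj₁ ∘ proj₂) eq)) (ℤₚ.+-comm y (+ 1)))

position : ℕ → ℕ → State
position a b = ℤ.- (+ a ℤ.+ + a) , + b , + a ℤ.* + a - + triangle b

f⁺-position : ∀ a b → f⁺ (position a b) ≡ position a (suc b)
f⁺-position a b = cong₂ (λ y z → (ℤ.- (+ a ℤ.+ + a) , y , z))
  (ℤₚ.+-comm (+ b) (+ 1)) (regroup (+ a ℤ.* + a) (+ triangle b) (+ b))
  where
  regroup : ∀ s t b → s - t - b ≡ s - (t ℤ.+ b)
  regroup = ℤ-Solver.solve-∀

f⁻-position : ∀ a b → f⁻ (position a b) ≡ position (suc a) b
f⁻-position a b = cong₂ (λ x z → (x , + b , z)) (shift (+ a)) (expand (+ a) (+ triangle b))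
  where
  shift : ∀ a → ℤ.- (a ℤ.+ a) - + 2 ≡ ℤ.- ((+ 1 ℤ.+ a) ℤ.+ (+ 1 ℤ.+ a))
  shift = ℤ-Solver.solve-∀
  expand : ∀ a t → a ℤ.* a - t - ℤ.- (a ℤ.+ a) ℤ.+ + 1 ≡ (+ 1 ℤ.+ a) ℤ.* (+ 1 ℤ.+ a) - t
  expand = ℤ-Solver.solve-∀

position-balance : ∀ a b →
  ℤ.- (+ a ℤ.+ + a) ℤ.+ + b ℤ.+ + (suc a * suc a)
    ≡ (+ a ℤ.* + a - + triangle b) ℤ.+ + suc (triangle (suc b))
position-balance a b = identity (+ a) (+ b) (+ triangle b)
  where
  identity : ∀ a b t →
    ℤ.- (a ℤ.+ a) ℤ.+ b ℤ.+ (+ 1 ℤ.+ a) ℤ.* (+ 1 ℤ.+ a) ≡ (a ℤ.* a - t) ℤ.+ (+ 1 ℤ.+ (t ℤ.+ b))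
  identity = ℤ-Solver.solve-∀

data Move (a b : ℕ) : Set where
  right : f (position a b) ≡ f⁺ (position a b) → Balanced a (suc b) → Move a b
  left  : f (position a b) ≡ f⁻ (position a b) → Balanced (suc a) b → Move a b

move : ∀ {a b} → Balanced a b → Move a b
move {a} {b} bal with triangle (suc b) <? suc a * suc a
... | yes goes-right = right
  (f≡f⁺ (balanceℤ⇒≤ (position-balance a b) (ℤ.+≤+ goes-right)))
  record { sq≤triangle = ≤-trans (sq≤triangle bal) (m≤m+n _ _)
         ; triangle<sq = goes-right }
... | no goes-left = left
  (f≡f⁻ (goes-left ∘ ℤ.drop‿+≤+ ∘ balanceℤ⇒≥ (position-balance a b)))
  record { sq≤triangle = ≮⇒≥ goes-left
         ; triangle<sq = <-≤-trans (triangle<sq bal) (*-mono-≤ (n≤1+n (suc a)) (n≤1+n (suc a))) }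

record Reached (k a b : ℕ) : Set where
  field
    moves         : a + b ≡ k
    iter≡position : iter k σ₀ ≡ position a b
    balanced      : Balanced a b

open Reached

reached⇒floor : ∀ {k a b} → Reached k a b → IsFloorKαβ k (+ a)
reached⇒floor {a = a} reached =
  subst (λ k → IsFloorKαβ k (+ a)) (moves reached) (balanced⇒floor (balanced reached))

data Step (k a b : ℕ) : Set where
  right : iter (suc k) σ₀ ≡ f⁺ (iter k σ₀) → Reached (suc k) a (suc b) → Step k a b
  left  : iter (suc k) σ₀ ≡ f⁻ (iter k σ₀) → Reached (suc k) (suc a) b → Step k a b

step : ∀ {k a b} → Reached k a b → Step k a b
step {a = a} {b} record { moves = a+b≡k ; iter≡position = at ; balanced = bal } with move bal
... | right f≡f⁺ bal′ = right (subst (λ σ → f σ ≡ f⁺ σ) (sym at) f≡f⁺) record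
  { moves         = trans (+-suc a b) (cong suc a+b≡k)
  ; iter≡position = trans (cong f at) (trans f≡f⁺ (f⁺-position a b))
  ; balanced      = bal′
  }
... | left f≡f⁻ bal′ = left (subst (λ σ → f σ ≡ f⁻ σ) (sym at) f≡f⁻) record
  { moves         = cong suc a+b≡k
  ; iter≡position = trans (cong f at) (trans f≡f⁻ (f⁻-position a b))
  ; balanced      = bal′
  }

reachable : ∀ k → Σ ℕ λ a → Σ ℕ λ b → Reached k a b
reachable zero = 0 , 0 , record
  { moves         = refl
  ; iter≡position = refl
  ; balanced      = record { sq≤triangle = z≤n ; triangle<sq = z<s }
  }
reachable (suc k) with reachable k
... | a , b , reached with step reached
...   | right _ reached′ = a , suc b , reached′
...   | left  _ reached′ = suc a , b , reached′

proposition3p3 : (k : ℕ) →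
    Σ ℤ (λ n₁ → Σ ℤ (λ n₀ →
      IsFloorKαβ (suc k) n₁ × IsFloorKαβ k n₀ ×
      (iter (suc k) σ₀ ≡ f⁻ (iter k σ₀) → n₁ - n₀ ≡ + 1) ×
      (iter (suc k) σ₀ ≡ f⁺ (iter k σ₀) → n₁ - n₀ ≡ + 0)))
proposition3p3 k with reachable k
... | a , b , reached with step reached
...   | right f⁺-step reached′ =
  + a , + a , reached⇒floor reached′ , reached⇒floor reached ,
  (λ f⁻-step → ⊥-elim (f⁺≢f⁻ (iter k σ₀) (trans (sym f⁺-step) f⁻-step))) ,
  (λ _ → ℤₚ.+-inverseʳ (+ a))
...   | left f⁻-step reached′ =
  + suc a , + a , reached⇒floor reached′ , reached⇒floor reached ,
  (λ _ → //-rightDividesʳ (+ a) (+ 1)) ,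
  (λ f⁺-step → ⊥-elim (f⁺≢f⁻ (iter k σ₀) (trans (sym f⁺-step) f⁻-step)))
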